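{- Let $(Q,\le,\cdot,1,\textit{dom},\textit{cod})$ be a modal quantale and put $Q_{\textit{dom}}=\{\alpha\in Q\mid\textit{dom}(\alpha)=\alpha\}$. For $\alpha,\beta\in Q$ define $|\alpha\rangle\beta=\textit{dom}(\alpha\cdot\beta)$ and $\langle\alpha|\beta=\textit{cod}(\beta\cdot\alpha)$. Then for all $\alpha\in Q$ and $\rho,\sigma\in Q_{\textit{dom}}$: $\rho\cdot|\alpha\rangle\sigma=\bot$ if and only if $\langle\alpha|\rho\cdot\sigma=\bot$.
   Context: A modal quantale is a complete lattice $(Q,\le)$ (least element $\bot$, binary sup $\vee$) with an associative operation $\cdot$ with two-sided unit $1$ preserving arbitrary sups in each argument, and maps $\textit{dom},\textit{cod}:Q\to Q$ such that for all $\alpha,\beta$: $\alpha\le\textit{dom}(\alpha)\cdot\alpha$, $\textit{dom}(\alpha\cdot\textit{dom}(\beta))=\textit{dom}(\alpha\cdot\beta)$, $\textit{dom}(\alpha)\le1$, $\textit{dom}(\bot)=\bot$, $\textit{dom}(\alpha\vee\beta)=\textit{dom}(\alpha)\vee\textit{dom}(\beta)$; $\alpha\le\alpha\cdot\textit{cod}(\alpha)$, $\textit{cod}(\textit{cod}(\alpha)\cdot\beta)=\textit{cod}(\alpha\cdot\beta)$, $\textit{cod}(\alpha)\le1$, $\textit{cod}(\bot)=\bot$, $\textit{cod}(\alpha\vee\beta)=\textit{cod}(\alpha)\vee\textit{cod}(\beta)$; and $\textit{dom}\circ\textit{cod}=\textit{cod}$, $\textit{cod}\circ\textit{dom}=\textit{dom}$.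 The expression $\langle\alpha|\rho\cdot\sigma$ means $(\langle\alpha|\rho)\cdot\sigma$. -}

module Defs where

open import Level using (Level; suc; _⊔_)
open import Relation.Binary.PropositionalEquality using (_≡_)
open import Relation.Binary.Structures using (IsPartialOrder)
open import Data.Product using (Σ; _×_; ∃)

record ModalQuantale (c : Level) : Set (suc c) where
  infixl 7 _·_
  infixl 6 _∨_
  infix 4 _≤_
  field
    Q       : Set c
    _≤_     : Q → Q → Set c
    isPartialOrder : IsPartialOrder _≡_ _≤_
    ⋁       : (Q → Set c) → Q
    ⋁-upper : (S : Q → Set c) → ∀ x → S x → x ≤ ⋁ S
    ⋁-least : (S : Q → Set c) → ∀ z → (∀ x → S x → x ≤ z) → ⋁ S ≤ z
    ⊥       : Q
    ⊥-least : ∀ x → ⊥ ≤ x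
    _∨_     : Q → Q → Q
    ∨-upperˡ : ∀ x y → x ≤ x ∨ y
    ∨-upperʳ : ∀ x y → y ≤ x ∨ y
    ∨-least  : ∀ x y z → x ≤ z → y ≤ z → x ∨ y ≤ z
    _·_     : Q → Q → Q
    1#      : Q
    ·-assoc : ∀ x y z → (x · y) · z ≡ x · (y · z)
    ·-identityˡ : ∀ x → 1# · x ≡ x
    ·-identityʳ : ∀ x → x · 1# ≡ x
    ·-⋁ˡ : ∀ (S : Q → Set c) a →
           ⋁ S · a ≡ ⋁ (λ y → Σ Q (λ x → S x × (y ≡ x · a)))
    ·-⋁ʳ : ∀ a (S : Q → Set c) →
           a · ⋁ S ≡ ⋁ (λ y → Σ Q (λ x → S x × (y ≡ a · x)))
    dom cod : Q → Q
    dom-absorb : ∀ α → α ≤ dom α · α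
    dom-local  : ∀ α β → dom (α · dom β) ≡ dom (α · β)
    dom-sub1   : ∀ α → dom α ≤ 1#
    dom-⊥      : dom ⊥ ≡ ⊥
    dom-∨      : ∀ α β → dom (α ∨ β) ≡ dom α ∨ dom β
    cod-absorb : ∀ α → α ≤ α · cod α
    cod-local  : ∀ α β → cod (cod α · β) ≡ cod (α · β)
    cod-sub1   : ∀ α → cod α ≤ 1#
    cod-⊥      : cod ⊥ ≡ ⊥
    cod-∨      : ∀ α β → cod (α ∨ β) ≡ cod α ∨ cod β
    dom-cod    : ∀ α → dom (cod α) ≡ cod α
    cod-dom    : ∀ α → cod (dom α) ≡ dom α

  IsDom : Q → Set c
  IsDom α = dom α ≡ α

  ∣_⟩_ : Q → Q → Q
  ∣ α ⟩ β = dom (α · β)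

  ⟨_∣_ : Q → Q → Q
  ⟨ α ∣ β = cod (β · α)

{-# OPTIONS --safe #-}
-- A product vanishes exactly when the product with the domain (codomain) of
-- its right (left) factor does: by locality both have the same domain
-- (codomain), and dom x = ⊥ forces x = ⊥ because x ≤ dom x · x.  So both
-- sides of the equivalence say ρ · α · σ = ⊥.
module Submission where

open import Defs
open import Level using (Level; Lift)
open import Relation.Binary.PropositionalEquality using (_≡_; refl; sym; trans; cong; subst)
open import Relation.Binary.Structures using (IsPartialOrder)
open import Relation.Nullary using (¬_)
open import Data.Product using (_×_; _,_)
import Data.Empty as Empty
open import Function.Bundles using (_⇔_; mk⇔; Equivalence)
open import Function.Properties.Equivalence using (⇔-setoid)
import Relation.Binary.Reasoning.Setoid as SetoidReasoning

module ModalQuantaleProperties {c : Level} (M : ModalQuantale c) where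
  open ModalQuantale M
  open IsPartialOrder isPartialOrder using (antisym)

  ≤⊥⇒≡⊥ : ∀ {x} → x ≤ ⊥ → x ≡ ⊥
  ≤⊥⇒≡⊥ {x} x≤⊥ = antisym x≤⊥ (⊥-least x)

  ⋁-empty : (S : Q → Set c) → (∀ x → ¬ S x) → ⋁ S ≡ ⊥
  ⋁-empty S empty = ≤⊥⇒≡⊥ (⋁-least S ⊥ λ x Sx → Empty.⊥-elim (empty x Sx))

  ∅ : Q → Set c
  ∅ _ = Lift c Empty.⊥

  ⋁-∅ : ⋁ ∅ ≡ ⊥
  ⋁-∅ = ⋁-empty ∅ λ _ ()

  zeroˡ : ∀ a → ⊥ · a ≡ ⊥
  zeroˡ a = trans (cong (_· a) (sym ⋁-∅))
                  (trans (·-⋁ˡ ∅ a) (⋁-empty _ λ { _ (_ , () , _) }))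

  zeroʳ : ∀ a → a · ⊥ ≡ ⊥
  zeroʳ a = trans (cong (a ·_) (sym ⋁-∅))
                  (trans (·-⋁ʳ a ∅) (⋁-empty _ λ { _ (_ , () , _) }))

  dom≡⊥⇔≡⊥ : ∀ x → dom x ≡ ⊥ ⇔ x ≡ ⊥
  dom≡⊥⇔≡⊥ x = mk⇔ to (λ { refl → dom-⊥ })
    where
    to : dom x ≡ ⊥ → x ≡ ⊥
    to dx≡⊥ = ≤⊥⇒≡⊥ (subst (x ≤_) (trans (cong (_· x) dx≡⊥) (zeroˡ x)) (dom-absorb x))

  cod≡⊥⇔≡⊥ : ∀ x → cod x ≡ ⊥ ⇔ x ≡ ⊥
  cod≡⊥⇔≡⊥ x = mk⇔ to (λ { refl → cod-⊥ })
    where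
    to : cod x ≡ ⊥ → x ≡ ⊥
    to cx≡⊥ = ≤⊥⇒≡⊥ (subst (x ≤_) (trans (cong (x ·_) cx≡⊥) (zeroʳ x)) (cod-absorb x))

  open SetoidReasoning (⇔-setoid c)

  ·dom≡⊥⇔·≡⊥ : ∀ α β → α · dom β ≡ ⊥ ⇔ α · β ≡ ⊥
  ·dom≡⊥⇔·≡⊥ α β = begin
    α · dom β ≡ ⊥        ≈⟨ dom≡⊥⇔≡⊥ (α · dom β) ⟨
    dom (α · dom β) ≡ ⊥  ≡⟨ cong (_≡ ⊥) (dom-local α β) ⟩
    dom (α · β) ≡ ⊥      ≈⟨ dom≡⊥⇔≡⊥ (α · β) ⟩
    α · β ≡ ⊥            ∎

  cod·≡⊥⇔·≡⊥ : ∀ α β → cod α · β ≡ ⊥ ⇔ α · β ≡ ⊥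
  cod·≡⊥⇔·≡⊥ α β = begin
    cod α · β ≡ ⊥        ≈⟨ cod≡⊥⇔≡⊥ (cod α · β) ⟨
    cod (cod α · β) ≡ ⊥  ≡⟨ cong (_≡ ⊥) (cod-local α β) ⟩
    cod (α · β) ≡ ⊥      ≈⟨ cod≡⊥⇔≡⊥ (α · β) ⟩
    α · β ≡ ⊥            ∎

  ·∣⟩≡⊥⇔⟨∣·≡⊥ : ∀ α ρ σ → ρ · ∣ α ⟩ σ ≡ ⊥ ⇔ (⟨ α ∣ ρ) · σ ≡ ⊥
  ·∣⟩≡⊥⇔⟨∣·≡⊥ α ρ σ = begin
    ρ · dom (α · σ) ≡ ⊥  ≈⟨ ·dom≡⊥⇔·≡⊥ ρ (α · σ) ⟩
    ρ · (α · σ) ≡ ⊥      ≡⟨ cong (_≡ ⊥) (·-assoc ρ α σ) ⟨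
    ρ · α · σ ≡ ⊥        ≈⟨ cod·≡⊥⇔·≡⊥ (ρ · α) σ ⟨
    cod (ρ · α) · σ ≡ ⊥  ∎

lemma11p1 : {c : Level} (M : ModalQuantale c) →
    let open ModalQuantale M in
    ∀ (α ρ σ : Q) → IsDom ρ → IsDom σ →
    ((ρ · ∣ α ⟩ σ ≡ ⊥ → (⟨ α ∣ ρ) · σ ≡ ⊥)
    × ((⟨ α ∣ ρ) · σ ≡ ⊥ → ρ · ∣ α ⟩ σ ≡ ⊥))
lemma11p1 M α ρ σ _ _ = to , from
  where
  open ModalQuantaleProperties M
  open Equivalence (·∣⟩≡⊥⇔⟨∣·≡⊥ α ρ σ)
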